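{- Let $G$ and $H$ be connected graphs, each having at least two vertices, with $\chi(G)=k_1$ and $\chi(H)=k_2$. Then $\chi_{lid}(G \square H) \leq k_1 k_2 - 1$.
   Context: $\chi(G)$ is the chromatic number of $G$. A proper $k$-coloring of a graph $G$ is a map $f:V(G)\to\{1,\dots,k\}$ with $f(u)\neq f(v)$ for every edge $uv$. For a vertex $v$, $N[v]$ denotes its closed neighborhood ($v$ together with all its neighbors), and for a set $S$ of vertices $f(S)=\{f(x):x\in S\}$. A locally identifying coloring (lid-coloring) of $G$ is a proper coloring $f$ such that for every edge $uv$ with $N[u]\neq N[v]$ we have $f(N[u])\neq f(N[v])$. The lid-chromatic number $\chi_{lid}(G)$ is the smallest $k$ such that $G$ has a lid-coloring with $k$ colors. The Cartesian product $G\square H$ has vertex set $V(G)\times V(H)$, where $(u_1,v_1)$ and $(u_2,v_2)$ are adjacent iff either $u_1=u_2$ and $v_1v_2\in E(H)$, or $v_1=v_2$ and $u_1u_2\in E(G)$. -}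

module Defs where

open import Data.Nat using (ℕ; _≤_)
open import Data.Fin using (Fin)
open import Data.Product using (Σ; _×_; _,_; ∃)
open import Data.Sum using (_⊎_)
open import Relation.Nullary using (¬_)
open import Relation.Binary.PropositionalEquality using (_≡_)
open import Relation.Binary using (Decidable)
open import Level using (0ℓ)

record Graph : Set₁ where
  field
    n     : ℕ
    Adj   : Fin n → Fin n → Set
    adj?  : Decidable Adj
    irrefl : ∀ {u} → ¬ Adj u u
    sym   : ∀ {u v} → Adj u v → Adj v u

open Graph public

Vertex : Graph → Set
Vertex G = Fin (n G)

data Walk (G : Graph) : Vertex G → Vertex G → Set where
  here : ∀ {u} → Walk G u u
  step : ∀ {u v w} → Adj G u v → Walk G v w → Walk G u w

Connected : Graph → Set
Connected G = ∀ u v → Walk G u v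

data ProdAdj (G H : Graph) : (Vertex G × Vertex H) → (Vertex G × Vertex H) → Set where
  inH : ∀ {u v₁ v₂} → Adj H v₁ v₂ → ProdAdj G H (u , v₁) (u , v₂)
  inG : ∀ {u₁ u₂ v} → Adj G u₁ u₂ → ProdAdj G H (u₁ , v) (u₂ , v)

module Coloring {V : Set} (E : V → V → Set) where

  InN : V → V → Set
  InN u w = (w ≡ u) ⊎ E u w

  Proper : {k : ℕ} → (V → Fin k) → Set
  Proper f = ∀ {u v} → E u v → ¬ (f u ≡ f v)

  ColorIn : {k : ℕ} → (V → Fin k) → V → Fin k → Set
  ColorIn f u c = ∃ λ w → InN u w × (f w ≡ c)

  SameN : V → V → Set
  SameN u v = ∀ w → (InN u w → InN v w) × (InN v w → InN u w)

  SameColorSet : {k : ℕ} → (V → Fin k) → V → V → Set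
  SameColorSet f u v = ∀ c → (ColorIn f u c → ColorIn f v c) × (ColorIn f v c → ColorIn f u c)

  LidColoring : {k : ℕ} → (V → Fin k) → Set
  LidColoring f = Proper f × (∀ {u v} → E u v → ¬ SameN u v → ¬ SameColorSet f u v)

  LidColorable : ℕ → Set
  LidColorable k = Σ (V → Fin k) LidColoring

  Colorable : ℕ → Set
  Colorable k = Σ (V → Fin k) Proper

ChromaticNumber : Graph → ℕ → Set
ChromaticNumber G k = Colorable k × (∀ m → Colorable m → k ≤ m)
  where open Coloring (Adj G)

Product : (G H : Graph) → Vertex G × Vertex H → Vertex G × Vertex H → Set
Product G H = ProdAdj G H

LidChromaticAtMost : Graph → Graph → ℕ → Set
LidChromaticAtMost G H k = LidColorable k
  where open Coloring (ProdAdj G H)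

-- Take proper colourings f of G and g of H, colour (p , q) by the pair
-- (f p , g q), and merge the pairs (0 , 0) and (1 , 1) into one colour, leaving
-- k₁ k₂ − 1 colours. The merged pairs differ in both coordinates, so the
-- colouring stays proper. For an edge (u , v₁)(u , v₂) along H pick a
-- G-neighbour u' of u (it exists as G is connected with two vertices): the
-- colour of (u' , v₁) is seen from (u , v₁), and unless it is the merged
-- colour it is carried only by vertices with colour pair (f u' , g v₁), none of
-- which lies in N[(u , v₂)]. If (f u' , g v₁) is merged then (f u' , g v₂) is
-- not, and (u' , v₂) separates the edge the other way. Edges along G are
-- symmetric.
module Submission where

open import Defs hiding (sym)
open import Data.Nat as ℕ using (ℕ; _≤_; _+_; _*_; _∸_; s≤s)
open import Data.Fin using (Fin; zero; suc; combine; punchOut; fromℕ<)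
open import Data.Fin.Properties using (combine-injective; punchOut-injective)
open import Data.Product using (∃; _×_; _,_; proj₁; proj₂)
open import Data.Sum using (_⊎_; inj₁; inj₂)
open import Data.Empty using (⊥-elim)
open import Function using (_∘_)
open import Relation.Nullary using (¬_; Dec; yes; no)
open import Relation.Binary.PropositionalEquality using (_≡_; _≢_; refl; sym)

other-element : ∀ {k} → 2 ≤ k → (i : Fin k) → ∃ λ j → i ≢ j
other-element (s≤s (s≤s _)) zero    = suc zero , λ ()
other-element (s≤s (s≤s _)) (suc _) = zero , λ ()

module _ (G : Graph) where

  walk-first-step : ∀ {u v} → Walk G u v → u ≢ v → ∃ (Adj G u)
  walk-first-step here          u≢u = ⊥-elim (u≢u refl)
  walk-first-step (step {v = w} e _) _ = w , e

  NoIsolatedVertex : Set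
  NoIsolatedVertex = ∀ u → ∃ (Adj G u)

  connected⇒noIsolatedVertex : Connected G → 2 ≤ n G → NoIsolatedVertex
  connected⇒noIsolatedVertex conn 2≤n u =
    let v , u≢v = other-element 2≤n u in walk-first-step (conn u v) u≢v

  proper⇒twoColours : ∀ {k} {f : Vertex G → Fin k} → Coloring.Proper (Adj G) f →
                      ∀ {u v} → Adj G u v → ∃ λ m → k ≡ 2 + m
  proper⇒twoColours {ℕ.zero}          {f} _      {u}     _ with f u
  ... | ()
  proper⇒twoColours {ℕ.suc ℕ.zero}    {f} proper {u} {v} e with f u | f v | proper e
  ... | zero | zero | fu≢fv = ⊥-elim (fu≢fv refl)
  proper⇒twoColours {ℕ.suc (ℕ.suc m)}     _      _ = m , refl

module Merge {m₁ m₂ : ℕ} where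

  K₁ K₂ : ℕ
  K₁ = 2 + m₁
  K₂ = 2 + m₂

  data Merged : Fin K₁ → Fin K₂ → Set where
    zero-zero : Merged zero zero
    one-one   : Merged (suc zero) (suc zero)

  merged? : ∀ a b → Dec (Merged a b)
  merged? zero             zero             = yes zero-zero
  merged? zero             (suc _)          = no λ ()
  merged? (suc zero)       zero             = no λ ()
  merged? (suc zero)       (suc zero)       = yes one-one
  merged? (suc zero)       (suc (suc _))    = no λ ()
  merged? (suc (suc _))    _                = no λ ()

  merged-functionalʳ : ∀ {a b d} → Merged a b → Merged a d → b ≡ d
  merged-functionalʳ zero-zero zero-zero = refl
  merged-functionalʳ one-one   one-one   = refl

  merged-functionalˡ : ∀ {a c b} → Merged a b → Merged c b → a ≡ c
  merged-functionalˡ zero-zero zero-zero = refl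
  merged-functionalˡ one-one   one-one   = refl

  -- The pair (0 , 0) is sent to the cell of (1 , 1), which frees index 0.
  cell : Fin K₁ → Fin K₂ → Fin (K₁ * K₂)
  cell a b with merged? a b
  ... | yes _ = combine {K₁} {K₂} (suc zero) (suc zero)
  ... | no  _ = combine a b

  cell-injective : ∀ a b c d → cell a b ≡ cell c d →
                   (a ≡ c × b ≡ d) ⊎ (Merged a b × Merged c d)
  cell-injective a b c d eq with merged? a b | merged? c d
  ... | yes mab | yes mcd = inj₂ (mab , mcd)
  ... | no  ¬mab | no _   = inj₁ (combine-injective a b c d eq)
  ... | yes _   | no ¬mcd with combine-injective (suc zero) (suc zero) c d eq
  ...   | refl , refl = ⊥-elim (¬mcd one-one)
  cell-injective a b c d eq | no ¬mab | yes _
    with combine-injective a b (suc zero) (suc zero) eq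
  ... | refl , refl = ⊥-elim (¬mab one-one)

  zero≢cell : ∀ a b → zero ≢ cell a b
  zero≢cell a b eq with merged? a b
  ... | yes _ with () ← eq
  ... | no ¬mab with combine-injective zero zero a b eq
  ...   | refl , refl = ¬mab zero-zero

  code : Fin K₁ → Fin K₂ → Fin (K₁ * K₂ ∸ 1)
  code a b = punchOut (zero≢cell a b)

  code-injective : ∀ a b c d → code a b ≡ code c d →
                   (a ≡ c × b ≡ d) ⊎ (Merged a b × Merged c d)
  code-injective a b c d =
    cell-injective a b c d ∘ punchOut-injective (zero≢cell a b) (zero≢cell c d)

  code-injective-unmerged : ∀ a b c d → ¬ Merged a b → code a b ≡ code c d →
                            a ≡ c × b ≡ d
  code-injective-unmerged a b c d ¬mab eq with code-injective a b c d eq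
  ... | inj₁ a≡c×b≡d = a≡c×b≡d
  ... | inj₂ (mab , _) = ⊥-elim (¬mab mab)

  code-injectiveʳ : ∀ a b d → code a b ≡ code a d → b ≡ d
  code-injectiveʳ a b d eq with code-injective a b a d eq
  ... | inj₁ (_ , b≡d)    = b≡d
  ... | inj₂ (mab , mad) = merged-functionalʳ mab mad

  code-injectiveˡ : ∀ a b c → code a b ≡ code c b → a ≡ c
  code-injectiveˡ a b c eq with code-injective a b c b eq
  ... | inj₁ (a≡c , _)    = a≡c
  ... | inj₂ (mab , mcb) = merged-functionalˡ mab mcb

module ProductColouring
  (G H : Graph) {m₁ m₂ : ℕ}
  (f : Vertex G → Fin (2 + m₁)) (g : Vertex H → Fin (2 + m₂))
  (f-proper : Coloring.Proper (Adj G) f) (g-proper : Coloring.Proper (Adj H) g)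
  where

  open Merge {m₁} {m₂}
  open Coloring (ProdAdj G H)

  V : Set
  V = Vertex G × Vertex H

  colour : V → Fin (K₁ * K₂ ∸ 1)
  colour (p , q) = code (f p) (g q)

  MergedAt : V → Set
  MergedAt (p , q) = Merged (f p) (g q)

  colour-proper : Proper colour
  colour-proper (inH {u} {v₁} {v₂} e) = g-proper e ∘ code-injectiveʳ (f u) (g v₁) (g v₂)
  colour-proper (inG {u₁} {u₂} {v} e) = f-proper e ∘ code-injectiveˡ (f u₁) (g v) (f u₂)

  closedNeighbour-line : ∀ {u v p q} → InN (u , v) (p , q) → p ≡ u ⊎ q ≡ v
  closedNeighbour-line (inj₁ refl)     = inj₁ refl
  closedNeighbour-line (inj₂ (inH _)) = inj₁ refl
  closedNeighbour-line (inj₂ (inG _)) = inj₂ refl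

  unmerged-colour-absent : ∀ {x} p q → ¬ MergedAt (p , q) →
    (∀ {p' q'} → InN x (p' , q') → f p' ≢ f p ⊎ g q' ≢ g q) →
    ¬ ColorIn colour x (colour (p , q))
  unmerged-colour-absent p q ¬m avoids ((p' , q') , w∈N , eq)
    with code-injective-unmerged (f p) (g q) (f p') (g q') ¬m (sym eq) | avoids w∈N
  ... | fp≡fp' , _ | inj₁ fp'≢fp = fp'≢fp (sym fp≡fp')
  ... | _ , gq≡gq' | inj₂ gq'≢gq = gq'≢gq (sym gq≡gq')

  separatesᴴ : ∀ {u u' v₁ v₂} → Adj H v₁ v₂ → Adj G u u' → ¬ MergedAt (u' , v₁) →
               ¬ ColorIn colour (u , v₂) (colour (u' , v₁))
  separatesᴴ {u} {u'} {v₁} {v₂} e e' ¬m =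
    unmerged-colour-absent _ _ ¬m (case ∘ closedNeighbour-line)
    where
    case : ∀ {p q} → p ≡ u ⊎ q ≡ v₂ → f p ≢ f u' ⊎ g q ≢ g v₁
    case (inj₁ refl) = inj₁ (f-proper e')
    case (inj₂ refl) = inj₂ (g-proper (Graph.sym H e))

  separatesᴳ : ∀ {u₁ u₂ v v'} → Adj G u₁ u₂ → Adj H v v' → ¬ MergedAt (u₁ , v') →
               ¬ ColorIn colour (u₂ , v) (colour (u₁ , v'))
  separatesᴳ {u₁} {u₂} {v} {v'} e e' ¬m =
    unmerged-colour-absent _ _ ¬m (case ∘ closedNeighbour-line)
    where
    case : ∀ {p q} → p ≡ u₂ ⊎ q ≡ v → f p ≢ f u₁ ⊎ g q ≢ g v'
    case (inj₁ refl) = inj₁ (f-proper (Graph.sym G e))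
    case (inj₂ refl) = inj₂ (g-proper e')

  separated⇒differentColourSets : ∀ {x y} z w → InN x z → InN y w →
    (¬ MergedAt z → ¬ ColorIn colour y (colour z)) →
    (¬ MergedAt w → ¬ ColorIn colour x (colour w)) →
    ¬ (MergedAt z × MergedAt w) → ¬ SameColorSet colour x y
  separated⇒differentColourSets z w z∈Nx w∈Ny z-absent w-absent ¬both same
    with merged? _ _ | merged? _ _
  ... | no ¬mz | _ = z-absent ¬mz (proj₁ (same (colour z)) (z , z∈Nx , refl))
  ... | yes _ | no ¬mw = w-absent ¬mw (proj₂ (same (colour w)) (w , w∈Ny , refl))
  ... | yes mz | yes mw = ¬both (mz , mw)

  lidColourable : NoIsolatedVertex G → NoIsolatedVertex H → LidColorable (K₁ * K₂ ∸ 1)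
  lidColourable noIsoG noIsoH = colour , colour-proper , identifies
    where
    -- Every edge is separated, including those with N[x] = N[y].
    identifies : ∀ {x y} → ProdAdj G H x y → ¬ SameN x y → ¬ SameColorSet colour x y
    identifies (inH {u} e) _ =
      let u' , e' = noIsoG u in
      separated⇒differentColourSets _ _ (inj₂ (inG e')) (inj₂ (inG e'))
        (separatesᴴ e e') (separatesᴴ (Graph.sym H e) e')
        (λ (m , m') → g-proper e (merged-functionalʳ m m'))
    identifies (inG {v = v} e) _ =
      let v' , e' = noIsoH v in
      separated⇒differentColourSets _ _ (inj₂ (inH e')) (inj₂ (inH e'))
        (separatesᴳ e e') (separatesᴳ (Graph.sym G e) e')
        (λ (m , m') → f-proper e (merged-functionalˡ m m'))

corollary1 : (G H : Graph) (k₁ k₂ : ℕ) →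
    Connected G → Connected H →
    2 ≤ n G → 2 ≤ n H →
    ChromaticNumber G k₁ → ChromaticNumber H k₂ →
    LidChromaticAtMost G H (k₁ * k₂ ∸ 1)
corollary1 G H k₁ k₂ connG connH 2≤nG 2≤nH ((f , f-proper) , _) ((g , g-proper) , _)
  with noIsoG ← connected⇒noIsolatedVertex G connG 2≤nG
     | noIsoH ← connected⇒noIsolatedVertex H connH 2≤nH
  with _ , refl ← proper⇒twoColours G f-proper (proj₂ (noIsoG (fromℕ< 2≤nG)))
     | _ , refl ← proper⇒twoColours H g-proper (proj₂ (noIsoH (fromℕ< 2≤nH)))
  = ProductColouring.lidColourable G H f g f-proper g-proper noIsoG noIsoH
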